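{- Let $p,q\geq 1$ and $f(1),\ldots,f(q)\geq 1$ be natural numbers, let $\mathbf{T}=\mathbf{2}^p\times\prod_{i=1}^q\widehat{\mathbf{F}_{f(i)}}$, and let $\mathbf{S}\leq\mathbf{T}$ be a subalgebra isomorphic to $\prod_{i=1}^q\widehat{\mathbf{F}_{f(i)}}$. Then there is a sequence of subalgebras $\mathbf{T}_0,\ldots,\mathbf{T}_p$ of $\mathbf{T}$ such that $\mathbf{T}_0=\mathbf{S}$, $\mathbf{T}_k\leq\mathbf{T}_{k+1}$ for $k=0,\ldots,p-1$, and $\mathbf{T}_k\cong\mathbf{2}^k\times\prod_{i=1}^q\widehat{\mathbf{F}_{f(i)}}$ for $k=0,\ldots,p$.
   Context: A pseudocomplemented semilattice (p-semilattice) is an algebra $\langle P;\wedge,{}^*,0\rangle$ such that $\langle P;\wedge\rangle$ is a meet-semilattice with least element $0$ and, for all $x,a\in P$, $x\wedge a=0$ iff $x\leq a^*$; subalgebras and products are taken with respect to $\wedge,{}^*,0$. Every boolean algebra is a p-semilattice (with ${}^*$ the complement). $\mathbf{2}$ is the two-element boolean algebra. $\mathbf{F}_n$ denotes the finite boolean algebra with $n$ atoms (so $\mathbf{F}_0$ is the one-element boolean algebra). For a p-semilattice $\mathbf{B}$, $\widehat{\mathbf{B}}$ is the p-semilattice obtained from $\mathbf{B}$ by adding a new top element (so $\widehat{\mathbf{F}_0}=\mathbf{2}$). -}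

module Defs where

open import Data.Nat using (ℕ; zero; suc)
open import Data.Fin using (Fin)
open import Data.Bool using (Bool; true; false; _∧_; not)
open import Data.Vec using (Vec; zipWith; map; replicate)
open import Data.Vec.Properties using (≡-dec)
open import Data.Bool.Properties using () renaming (_≟_ to _≟ᵇ_)
open import Data.Product using (Σ; _×_; _,_; proj₁; proj₂)
open import Relation.Binary.PropositionalEquality using (_≡_)
open import Relation.Binary.Structures using (IsEquivalence)
open import Relation.Nullary using (yes; no)

-- Signature of p-semilattices ⟨P; ∧, *, 0⟩ with a setoid equality.
record Alg : Set₁ where
  field
    Carrier : Set
    _≈_     : Carrier → Carrier → Set
    isEquiv : IsEquivalence _≈_
    _⊓_     : Carrier → Carrier → Carrier
    _*      : Carrier → Carrier
    𝟎       : Carrier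

open Alg

record _≅_ (A B : Alg) : Set where
  field
    to       : Carrier A → Carrier B
    from     : Carrier B → Carrier A
    to-cong  : ∀ {x y} → _≈_ A x y → _≈_ B (to x) (to y)
    from-cong : ∀ {x y} → _≈_ B x y → _≈_ A (from x) (from y)
    to-from  : ∀ y → _≈_ B (to (from y)) y
    from-to  : ∀ x → _≈_ A (from (to x)) x
    to-⊓     : ∀ x y → _≈_ B (to (_⊓_ A x y)) (_⊓_ B (to x) (to y))
    to-*     : ∀ x → _≈_ B (to (_* A x)) (_* B (to x))
    to-𝟎     : _≈_ B (to (𝟎 A)) (𝟎 B)

record Sub (A : Alg) : Set₁ where
  field
    member  : Carrier A → Set
    resp    : ∀ {x y} → _≈_ A x y → member x → member y
    clos-⊓  : ∀ {x y} → member x → member y → member (_⊓_ A x y)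
    clos-*  : ∀ {x} → member x → member (_* A x)
    has-𝟎   : member (𝟎 A)

open Sub

SubAlg : {A : Alg} → Sub A → Alg
SubAlg {A} S = record
  { Carrier = Σ (Carrier A) (member S)
  ; _≈_ = λ x y → _≈_ A (proj₁ x) (proj₁ y)
  ; isEquiv = record
      { refl = IsEquivalence.refl (isEquiv A)
      ; sym = IsEquivalence.sym (isEquiv A)
      ; trans = IsEquivalence.trans (isEquiv A) }
  ; _⊓_ = λ x y → (_⊓_ A (proj₁ x) (proj₁ y) , clos-⊓ S (proj₂ x) (proj₂ y))
  ; _* = λ x → (_* A (proj₁ x) , clos-* S (proj₂ x))
  ; 𝟎 = (𝟎 A , has-𝟎 S)
  }

_≐_ : {A : Alg} → Sub A → Sub A → Set
_≐_ {A} S U = ∀ x → (member S x → member U x) × (member U x → member S x)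

_⊆ˢ_ : {A : Alg} → Sub A → Sub A → Set
_⊆ˢ_ {A} S U = ∀ x → member S x → member U x

≡-isEquiv : {X : Set} → IsEquivalence (_≡_ {A = X})
≡-isEquiv = record
  { refl = Relation.Binary.PropositionalEquality.refl
  ; sym = Relation.Binary.PropositionalEquality.sym
  ; trans = Relation.Binary.PropositionalEquality.trans }

-- F n : the finite boolean algebra with n atoms (subsets of an n-set, as
-- bit vectors), equivalently the power 2ⁿ of the two-element boolean algebra.
F : ℕ → Alg
F n = record
  { Carrier = Vec Bool n
  ; _≈_ = _≡_
  ; isEquiv = ≡-isEquiv
  ; _⊓_ = zipWith _∧_
  ; _* = map not
  ; 𝟎 = replicate n false
  }

Pow2 : ℕ → Alg
Pow2 = F

-- B̂ for B = F n : new top element added.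
data Hat (n : ℕ) : Set where
  old : Vec Bool n → Hat n
  top : Hat n

hat-⊓ : ∀ {n} → Hat n → Hat n → Hat n
hat-⊓ top y = y
hat-⊓ (old a) top = old a
hat-⊓ (old a) (old b) = old (zipWith _∧_ a b)

hat-* : ∀ {n} → Hat n → Hat n
hat-* {n} top = old (replicate n false)
hat-* {n} (old a) with ≡-dec _≟ᵇ_ a (replicate n false)
... | yes _ = top
... | no _ = old (map not a)

FHat : ℕ → Alg
FHat n = record
  { Carrier = Hat n
  ; _≈_ = _≡_
  ; isEquiv = ≡-isEquiv
  ; _⊓_ = hat-⊓
  ; _* = hat-*
  ; 𝟎 = old (replicate n false)
  }

_×A_ : Alg → Alg → Alg
A ×A B = record
  { Carrier = Carrier A × Carrier B
  ; _≈_ = λ x y → _≈_ A (proj₁ x) (proj₁ y) × _≈_ B (proj₂ x) (proj₂ y)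
  ; isEquiv = record
      { refl = IsEquivalence.refl (isEquiv A) , IsEquivalence.refl (isEquiv B)
      ; sym = λ e → IsEquivalence.sym (isEquiv A) (proj₁ e) , IsEquivalence.sym (isEquiv B) (proj₂ e)
      ; trans = λ e e' → IsEquivalence.trans (isEquiv A) (proj₁ e) (proj₁ e')
                       , IsEquivalence.trans (isEquiv B) (proj₂ e) (proj₂ e') }
  ; _⊓_ = λ x y → (_⊓_ A (proj₁ x) (proj₁ y) , _⊓_ B (proj₂ x) (proj₂ y))
  ; _* = λ x → (_* A (proj₁ x) , _* B (proj₂ x))
  ; 𝟎 = (𝟎 A , 𝟎 B)
  }

ΠA : (q : ℕ) → (Fin q → Alg) → Alg
ΠA q A = record
  { Carrier = (i : Fin q) → Carrier (A i)
  ; _≈_ = λ x y → ∀ i → _≈_ (A i) (x i) (y i)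
  ; isEquiv = record
      { refl = λ i → IsEquivalence.refl (isEquiv (A i))
      ; sym = λ e i → IsEquivalence.sym (isEquiv (A i)) (e i)
      ; trans = λ e e' i → IsEquivalence.trans (isEquiv (A i)) (e i) (e' i) }
  ; _⊓_ = λ x y i → _⊓_ (A i) (x i) (y i)
  ; _* = λ x i → _* (A i) (x i)
  ; 𝟎 = λ i → 𝟎 (A i)
  }

ΠHat : (q : ℕ) → (Fin q → ℕ) → Alg
ΠHat q f = ΠA q (λ i → FHat (f i))

TAlg : (p q : ℕ) → (Fin q → ℕ) → Alg
TAlg p q f = Pow2 p ×A ΠHat q f

-- The projection of S onto ∏ F̂_{f(i)} is injective, so Tₖ can be taken to consist of the
-- elements of T that agree with some element of S except possibly in the first k boolean
-- coordinates; then Tₖ ≅ 2ᵏ × S.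
-- For injectivity it suffices (via s ∧ s'* and the laws x ∧ x* = 0, 0* = 1) that an element u
-- of S whose ∏-part is 1 is the top of T. If not, φ(u) ≠ 1 lies below a coatom d of
-- ∏ F̂_{f(i)}, which is dense because f(i) ≥ 1. Then t = φ⁻¹(d) lies above u, so its ∏-part
-- is 1, and t* = φ⁻¹(d*) = 0 makes its boolean part all ones: t is the top of T, i.e. d = 1.
module Submission where

open import Defs
open import Data.Nat using (ℕ; zero; suc; _≤_; z≤n; s≤s)
open import Data.Fin using (Fin; zero; suc; toℕ; inject₁)
open import Data.Product using (Σ; _×_)

open import Algebra.Definitions using (Congruent₁; Congruent₂; LeftIdentity; RightInverse)
open import Data.Bool using (Bool; true; false; _∧_; not)
open import Data.Bool.Properties using (not-involutive; ∧-inverseʳ; ∧-identityʳ) renaming (_≟_ to _≟ᵇ_)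
open import Data.Empty using (⊥-elim)
open import Data.Fin using (_≟_)
open import Data.Fin.Properties using (toℕ-inject₁; toℕ≤pred[n]; all?; ¬∀⟶∃¬)
open import Data.Product using (_,_; proj₁; proj₂; ∃)
open import Data.Sum using (_⊎_; inj₁; inj₂)
open import Data.Unit using (⊤; tt)
open import Data.Vec using (Vec; []; _∷_; zipWith; map; replicate; truncate)
open import Data.Vec.Properties
  using (≡-dec; map-∘; map-cong; map-id; map-replicate; zipWith-inverseʳ; zipWith-identityʳ; ∷-injectiveʳ)
open import Function using (_∘_)
open import Relation.Binary.Bundles using (Setoid)
open import Relation.Binary.PropositionalEquality
  using (_≡_; _≢_; refl; sym; trans; cong; cong₂; subst)
open import Relation.Nullary using (¬_; Dec; yes; no)
import Relation.Binary.Reasoning.Setoid as SetoidReasoning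

open Alg
open Sub
open _≅_

private
  variable
    A : Set
    m n : ℕ

map-not-involutive : (v : Vec Bool n) → map not (map not v) ≡ v
map-not-involutive v = trans (sym (map-∘ not not v)) (trans (map-cong not-involutive v) (map-id v))

map-not≡replicate : (v : Vec Bool n) {b : Bool} → map not v ≡ replicate n b → v ≡ replicate n (not b)
map-not≡replicate {n} v {b} e =
  trans (sym (map-not-involutive v)) (trans (cong (map not) e) (map-replicate not b n))

∧-not-antisym : (v w : Vec Bool n) →
  zipWith _∧_ v (map not w) ≡ replicate n false → zipWith _∧_ w (map not v) ≡ replicate n false →
  v ≡ w
∧-not-antisym []          []          _ _ = refl
∧-not-antisym (true ∷ v)  (true ∷ w)  e e′ =
  cong (true ∷_) (∧-not-antisym v w (∷-injectiveʳ e) (∷-injectiveʳ e′))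
∧-not-antisym (false ∷ v) (false ∷ w) e e′ =
  cong (false ∷_) (∧-not-antisym v w (∷-injectiveʳ e) (∷-injectiveʳ e′))
∧-not-antisym (true ∷ v)  (false ∷ w) () _
∧-not-antisym (false ∷ v) (true ∷ w)  _ ()

EqualFrom : ℕ → Vec A n → Vec A n → Set
EqualFrom zero    v       w       = v ≡ w
EqualFrom (suc k) []      []      = ⊤
EqualFrom (suc k) (_ ∷ v) (_ ∷ w) = EqualFrom k v w

EqualFrom-refl : ∀ k (v : Vec A n) → EqualFrom k v v
EqualFrom-refl zero    v       = refl
EqualFrom-refl (suc k) []      = tt
EqualFrom-refl (suc k) (_ ∷ v) = EqualFrom-refl k v

EqualFrom-suc : ∀ k (v w : Vec A n) → EqualFrom k v w → EqualFrom (suc k) v w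
EqualFrom-suc _       []      []      _ = tt
EqualFrom-suc zero    (_ ∷ v) (_ ∷ w) e = ∷-injectiveʳ e
EqualFrom-suc (suc k) (_ ∷ v) (_ ∷ w) e = EqualFrom-suc k v w e

EqualFrom-zipWith : (f : A → A → A) → ∀ k {v v′ w w′ : Vec A n} →
  EqualFrom k v w → EqualFrom k v′ w′ → EqualFrom k (zipWith f v v′) (zipWith f w w′)
EqualFrom-zipWith f zero    e e′ = cong₂ (zipWith f) e e′
EqualFrom-zipWith f (suc k) {[]}    {[]}    {[]}    {[]}    _ _ = tt
EqualFrom-zipWith f (suc k) {_ ∷ _} {_ ∷ _} {_ ∷ _} {_ ∷ _} e e′ = EqualFrom-zipWith f k e e′

EqualFrom-map : (f : A → A) → ∀ k {v w : Vec A n} →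
  EqualFrom k v w → EqualFrom k (map f v) (map f w)
EqualFrom-map f zero    e = cong (map f) e
EqualFrom-map f (suc k) {[]}    {[]}    _ = tt
EqualFrom-map f (suc k) {_ ∷ _} {_ ∷ _} e = EqualFrom-map f k e

withPrefix : m ≤ n → Vec A m → Vec A n → Vec A n
withPrefix z≤n       []      v       = v
withPrefix (s≤s m≤n) (x ∷ u) (_ ∷ v) = x ∷ withPrefix m≤n u v

EqualFrom-withPrefix : (m≤n : m ≤ n) (u : Vec A m) (v : Vec A n) →
                       EqualFrom m (withPrefix m≤n u v) v
EqualFrom-withPrefix z≤n       []      v       = refl
EqualFrom-withPrefix (s≤s m≤n) (_ ∷ u) (_ ∷ v) = EqualFrom-withPrefix m≤n u v

truncate-withPrefix : (m≤n : m ≤ n) (u : Vec A m) (v : Vec A n) →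
                      truncate m≤n (withPrefix m≤n u v) ≡ u
truncate-withPrefix z≤n       []      v       = refl
truncate-withPrefix (s≤s m≤n) (x ∷ u) (_ ∷ v) = cong (x ∷_) (truncate-withPrefix m≤n u v)

withPrefix-truncate : (m≤n : m ≤ n) (v w : Vec A n) → EqualFrom m v w →
                      withPrefix m≤n (truncate m≤n v) w ≡ v
withPrefix-truncate z≤n       v       w       e = sym e
withPrefix-truncate (s≤s m≤n) (x ∷ v) (_ ∷ w) e = cong (x ∷_) (withPrefix-truncate m≤n v w e)

truncate-zipWith : (f : A → A → A) (m≤n : m ≤ n) (v w : Vec A n) →
  truncate m≤n (zipWith f v w) ≡ zipWith f (truncate m≤n v) (truncate m≤n w)
truncate-zipWith f z≤n       v       w       = refl
truncate-zipWith f (s≤s m≤n) (x ∷ v) (y ∷ w) = cong (f x y ∷_) (truncate-zipWith f m≤n v w)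

truncate-map : (f : A → A) (m≤n : m ≤ n) (v : Vec A n) →
               truncate m≤n (map f v) ≡ map f (truncate m≤n v)
truncate-map f z≤n       v       = refl
truncate-map f (s≤s m≤n) (x ∷ v) = cong (f x ∷_) (truncate-map f m≤n v)

truncate-replicate : (m≤n : m ≤ n) (x : A) → truncate m≤n (replicate n x) ≡ replicate m x
truncate-replicate z≤n       x = refl
truncate-replicate (s≤s m≤n) x = cong (x ∷_) (truncate-replicate m≤n x)

setoid : Alg → Setoid _ _
setoid A = record { Carrier = Carrier A ; _≈_ = _≈_ A ; isEquivalence = isEquiv A }

module _ {A B : Alg} (φ : A ≅ B) where
  open SetoidReasoning (setoid A)
  open Setoid (setoid B) using () renaming (sym to symᴮ)

  from-⊓ : Congruent₂ (_≈_ B) (_⊓_ B) →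
           ∀ x y → _≈_ A (from φ (_⊓_ B x y)) (_⊓_ A (from φ x) (from φ y))
  from-⊓ ⊓-cong x y = begin
    from φ (_⊓_ B x y)
      ≈⟨ from-cong φ (⊓-cong (symᴮ (to-from φ x)) (symᴮ (to-from φ y))) ⟩
    from φ (_⊓_ B (to φ (from φ x)) (to φ (from φ y)))
      ≈⟨ from-cong φ (to-⊓ φ (from φ x) (from φ y)) ⟨
    from φ (to φ (_⊓_ A (from φ x) (from φ y)))
      ≈⟨ from-to φ _ ⟩
    _⊓_ A (from φ x) (from φ y)
      ∎

  from-* : Congruent₁ (_≈_ B) (_* B) → ∀ x → _≈_ A (from φ (_* B x)) (_* A (from φ x))
  from-* *-cong x = begin
    from φ (_* B x)                  ≈⟨ from-cong φ (*-cong (symᴮ (to-from φ x))) ⟩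
    from φ (_* B (to φ (from φ x)))  ≈⟨ from-cong φ (to-* φ (from φ x)) ⟨
    from φ (to φ (_* A (from φ x)))  ≈⟨ from-to φ _ ⟩
    _* A (from φ x)                  ∎

  from-𝟎 : _≈_ A (from φ (𝟎 B)) (𝟎 A)
  from-𝟎 = begin
    from φ (𝟎 B)          ≈⟨ from-cong φ (to-𝟎 φ) ⟨
    from φ (to φ (𝟎 A))   ≈⟨ from-to φ (𝟎 A) ⟩
    𝟎 A                   ∎

≅-trans : {A B C : Alg} → A ≅ B → B ≅ C → A ≅ C
≅-trans {A} {C = C} φ ψ = record
  { to        = to ψ ∘ to φ
  ; from      = from φ ∘ from ψ
  ; to-cong   = to-cong ψ ∘ to-cong φ
  ; from-cong = from-cong φ ∘ from-cong ψ
  ; to-from   = λ z → transᶜ (to-cong ψ (to-from φ (from ψ z))) (to-from ψ z)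
  ; from-to   = λ x → Setoid.trans (setoid A) (from-cong φ (from-to ψ (to φ x))) (from-to φ x)
  ; to-⊓      = λ x y → transᶜ (to-cong ψ (to-⊓ φ x y)) (to-⊓ ψ (to φ x) (to φ y))
  ; to-*      = λ x → transᶜ (to-cong ψ (to-* φ x)) (to-* ψ (to φ x))
  ; to-𝟎      = transᶜ (to-cong ψ (to-𝟎 φ)) (to-𝟎 ψ)
  }
  where open Setoid (setoid C) using () renaming (trans to transᶜ)

×A-congˡ : {A B C : Alg} → B ≅ C → (A ×A B) ≅ (A ×A C)
×A-congˡ {A} φ = record
  { to        = λ (a , b) → a , to φ b
  ; from      = λ (a , c) → a , from φ c
  ; to-cong   = λ (e , e′) → e , to-cong φ e′
  ; from-cong = λ (e , e′) → e , from-cong φ e′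
  ; to-from   = λ (a , c) → reflᴬ , to-from φ c
  ; from-to   = λ (a , b) → reflᴬ , from-to φ b
  ; to-⊓      = λ (a , b) (a′ , b′) → reflᴬ , to-⊓ φ b b′
  ; to-*      = λ (a , b) → reflᴬ , to-* φ b
  ; to-𝟎      = reflᴬ , to-𝟎 φ
  }
  where open Setoid (setoid A) using () renaming (refl to reflᴬ)

-- Freeing the first k boolean coordinates of a subalgebra of 2ᵖ × B

Proj₂Injective : {p : ℕ} {B : Alg} → Sub (Pow2 p ×A B) → Set
Proj₂Injective {B = B} S =
  ∀ {s t} → member S s → member S t → _≈_ B (proj₂ s) (proj₂ t) → proj₁ s ≡ proj₁ t

module FreeCoordinates {p : ℕ} {B : Alg}
  (⊓-cong : Congruent₂ (_≈_ B) (_⊓_ B)) (*-cong : Congruent₁ (_≈_ B) (_* B))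
  (S : Sub (Pow2 p ×A B)) where

  open Setoid (setoid B) using () renaming (refl to reflᴮ; sym to symᴮ; trans to transᴮ)

  T : Alg
  T = Pow2 p ×A B

  AgreesBeyond : ℕ → Carrier T → Carrier T → Set
  AgreesBeyond k x s = _≈_ B (proj₂ x) (proj₂ s) × EqualFrom k (proj₁ x) (proj₁ s)

  freeBelow : ℕ → Sub T
  freeBelow k = record
    { member = λ x → ∃ λ s → member S s × AgreesBeyond k x s
    ; resp   = λ { (e , e′) (s , s∈S , x≈s , x~s) →
                   s , s∈S , transᴮ (symᴮ e′) x≈s , subst (λ v → EqualFrom k v (proj₁ s)) e x~s }
    ; clos-⊓ = λ { (s , s∈S , x≈s , x~s) (t , t∈S , y≈t , y~t) →
                   _⊓_ T s t , clos-⊓ S s∈S t∈S , ⊓-cong x≈s y≈t , EqualFrom-zipWith _∧_ k x~s y~t }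
    ; clos-* = λ { (s , s∈S , x≈s , x~s) →
                   _* T s , clos-* S s∈S , *-cong x≈s , EqualFrom-map not k x~s }
    ; has-𝟎  = 𝟎 T , has-𝟎 S , reflᴮ , EqualFrom-refl k (proj₁ (𝟎 T))
    }

  freeBelow-zero : freeBelow 0 ≐ S
  freeBelow-zero x =
      (λ (s , s∈S , x≈s , x≡s) → resp S (sym x≡s , symᴮ x≈s) s∈S)
    , (λ x∈S → x , x∈S , reflᴮ , refl)

  freeBelow-suc : ∀ k → freeBelow k ⊆ˢ freeBelow (suc k)
  freeBelow-suc k x (s , s∈S , x≈s , x~s) = s , s∈S , x≈s , EqualFrom-suc k (proj₁ x) (proj₁ s) x~s

  freeBelow-≅ : Proj₂Injective S → ∀ {k} → k ≤ p → SubAlg (freeBelow k) ≅ (Pow2 k ×A SubAlg S)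
  freeBelow-≅ proj₂-injective k≤p = record
    { to        = λ (x , s , s∈S , _) → truncate k≤p (proj₁ x) , (s , s∈S)
    ; from      = λ (u , (s , s∈S)) →
                    (withPrefix k≤p u (proj₁ s) , proj₂ s) ,
                    s , s∈S , reflᴮ , EqualFrom-withPrefix k≤p u (proj₁ s)
    ; to-cong   = λ { {_ , _ , s∈S , x≈s , _} {_ , _ , t∈S , y≈t , _} (e , e′) →
                      let s≈t = transᴮ (symᴮ x≈s) (transᴮ e′ y≈t)
                      in cong (truncate k≤p) e , proj₂-injective s∈S t∈S s≈t , s≈t }
    ; from-cong = λ (e , e′ , e″) → cong₂ (withPrefix k≤p) e e′ , e″
    ; to-from   = λ (u , (s , _)) → truncate-withPrefix k≤p u (proj₁ s) , refl , reflᴮ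
    ; from-to   = λ (x , s , _ , x≈s , x~s) → withPrefix-truncate k≤p (proj₁ x) (proj₁ s) x~s , symᴮ x≈s
    ; to-⊓      = λ (x , _) (y , _) → truncate-zipWith _∧_ k≤p (proj₁ x) (proj₁ y) , refl , reflᴮ
    ; to-*      = λ (x , _) → truncate-map not k≤p (proj₁ x) , refl , reflᴮ
    ; to-𝟎      = truncate-replicate k≤p false , refl , reflᴮ
    }

module ProjectionInjective {p : ℕ} {B : Alg}
  (⊓-cong : Congruent₂ (_≈_ B) (_⊓_ B)) (*-cong : Congruent₁ (_≈_ B) (_* B))
  (𝟎*-identityˡ : LeftIdentity (_≈_ B) (_* B (𝟎 B)) (_⊓_ B))
  (⊓-inverseʳ : RightInverse (_≈_ B) (𝟎 B) (_* B) (_⊓_ B))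
  (𝟎*-or-below-dense : ∀ x → _≈_ B x (_* B (𝟎 B))
       ⊎ ∃ λ d → _≈_ B (_* B d) (𝟎 B) × ¬ _≈_ B d (_* B (𝟎 B)) × _≈_ B (_⊓_ B x d) x)
  (S : Sub (Pow2 p ×A B)) (φ : SubAlg S ≅ B) where

  T : Alg
  T = Pow2 p ×A B

  open Setoid (setoid B) using () renaming (refl to reflᴮ; sym to symᴮ; trans to transᴮ)
  module ≈ᴮ = SetoidReasoning (setoid B)
  module ≈ᵀ = SetoidReasoning (setoid T)

  𝟏 : Carrier B
  𝟏 = _* B (𝟎 B)

  embed : Carrier B → Carrier T
  embed y = proj₁ (from φ y)

  ⊓ᵀ-cong : Congruent₂ (_≈_ T) (_⊓_ T)
  ⊓ᵀ-cong (e₁ , e₂) (e₁′ , e₂′) = cong₂ (zipWith _∧_) e₁ e₁′ , ⊓-cong e₂ e₂′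

  *ᵀ-cong : Congruent₁ (_≈_ T) (_* T)
  *ᵀ-cong (e₁ , e₂) = cong (map not) e₁ , *-cong e₂

  embed-𝟏 : _≈_ T (embed 𝟏) (replicate p true , 𝟏)
  embed-𝟏 = let open ≈ᵀ in begin
    embed 𝟏              ≈⟨ from-* φ *-cong (𝟎 B) ⟩
    _* T (embed (𝟎 B))   ≈⟨ *ᵀ-cong (from-𝟎 φ) ⟩
    _* T (𝟎 T)           ≈⟨ map-replicate not false p , reflᴮ ⟩
    replicate p true , 𝟏 ∎

  dense-above-is-𝟏 : ∀ {u} (u∈S : member S u) → _≈_ B (proj₂ u) 𝟏 →
    ∀ d → _≈_ B (_* B d) (𝟎 B) → _≈_ B (_⊓_ B (to φ (u , u∈S)) d) (to φ (u , u∈S)) →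
    _≈_ B d 𝟏
  dense-above-is-𝟏 {u} u∈S u₂≈𝟏 d d*≈𝟎 below = let open ≈ᴮ in begin
    d                 ≈⟨ to-from φ d ⟨
    to φ (from φ d)   ≈⟨ to-cong φ t≈embed𝟏 ⟩
    to φ (from φ 𝟏)   ≈⟨ to-from φ 𝟏 ⟩
    𝟏                 ∎
    where
    t : Carrier T
    t = embed d

    u⊓t≈u : _≈_ T (_⊓_ T u t) u
    u⊓t≈u = let open ≈ᵀ in begin
      _⊓_ T u t                        ≈⟨ ⊓ᵀ-cong (from-to φ (u , u∈S)) (refl , reflᴮ) ⟨
      _⊓_ T (embed (to φ (u , u∈S))) t ≈⟨ from-⊓ φ ⊓-cong (to φ (u , u∈S)) d ⟨
      embed (_⊓_ B (to φ (u , u∈S)) d) ≈⟨ from-cong φ below ⟩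
      embed (to φ (u , u∈S))           ≈⟨ from-to φ (u , u∈S) ⟩
      u                                ∎

    t₂≈𝟏 : _≈_ B (proj₂ t) 𝟏
    t₂≈𝟏 = let open ≈ᴮ in begin
      proj₂ t                   ≈⟨ 𝟎*-identityˡ (proj₂ t) ⟨
      _⊓_ B 𝟏 (proj₂ t)         ≈⟨ ⊓-cong u₂≈𝟏 reflᴮ ⟨
      _⊓_ B (proj₂ u) (proj₂ t) ≈⟨ proj₂ u⊓t≈u ⟩
      proj₂ u                   ≈⟨ u₂≈𝟏 ⟩
      𝟏                         ∎

    t*≈𝟎 : _≈_ T (_* T t) (𝟎 T)
    t*≈𝟎 = let open ≈ᵀ in begin
      _* T t         ≈⟨ from-* φ *-cong d ⟨
      embed (_* B d) ≈⟨ from-cong φ d*≈𝟎 ⟩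
      embed (𝟎 B)    ≈⟨ from-𝟎 φ ⟩
      𝟎 T            ∎

    t≈embed𝟏 : _≈_ T t (embed 𝟏)
    t≈embed𝟏 = let open ≈ᵀ in begin
      t                    ≈⟨ map-not≡replicate (proj₁ t) (proj₁ t*≈𝟎) , t₂≈𝟏 ⟩
      replicate p true , 𝟏 ≈⟨ embed-𝟏 ⟨
      embed 𝟏              ∎

  proj₂≈𝟏⇒proj₁≡true : ∀ {u} → member S u → _≈_ B (proj₂ u) 𝟏 → proj₁ u ≡ replicate p true
  proj₂≈𝟏⇒proj₁≡true {u} u∈S u₂≈𝟏 with 𝟎*-or-below-dense (to φ (u , u∈S))
  ... | inj₁ φu≈𝟏 = proj₁ (let open ≈ᵀ in begin
          u                      ≈⟨ from-to φ (u , u∈S) ⟨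
          embed (to φ (u , u∈S)) ≈⟨ from-cong φ φu≈𝟏 ⟩
          embed 𝟏                ≈⟨ embed-𝟏 ⟩
          replicate p true , 𝟏   ∎)
  ... | inj₂ (d , d*≈𝟎 , d≉𝟏 , below) =
    ⊥-elim (d≉𝟏 (dense-above-is-𝟏 u∈S u₂≈𝟏 d d*≈𝟎 below))

  proj₂≈𝟎⇒proj₁≡false : ∀ {w} → member S w → _≈_ B (proj₂ w) (𝟎 B) → proj₁ w ≡ replicate p false
  proj₂≈𝟎⇒proj₁≡false {w} w∈S w₂≈𝟎 =
    map-not≡replicate (proj₁ w) (proj₂≈𝟏⇒proj₁≡true (clos-* S w∈S) (*-cong w₂≈𝟎))

  proj₂-injective : Proj₂Injective S
  proj₂-injective {s} {t} s∈S t∈S s₂≈t₂ = ∧-not-antisym (proj₁ s) (proj₁ t)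
    (proj₂≈𝟎⇒proj₁≡false (clos-⊓ S s∈S (clos-* S t∈S))
       (transᴮ (⊓-cong s₂≈t₂ reflᴮ) (⊓-inverseʳ (proj₂ t))))
    (proj₂≈𝟎⇒proj₁≡false (clos-⊓ S t∈S (clos-* S s∈S))
       (transᴮ (⊓-cong (symᴮ s₂≈t₂) reflᴮ) (⊓-inverseʳ (proj₂ s))))

is-top? : (x : Hat n) → Dec (x ≡ top)
is-top? (old _) = no λ ()
is-top? top     = yes refl

hat-*-𝟎 : hat-* (old (replicate n false)) ≡ top
hat-*-𝟎 {n} with ≡-dec _≟ᵇ_ (replicate n false) (replicate n false)
... | yes _  = refl
... | no 0≢0 = ⊥-elim (0≢0 refl)

hat-*-coatom : 1 ≤ n → hat-* (old (replicate n true)) ≡ old (replicate n false)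
hat-*-coatom {suc n} _ with ≡-dec _≟ᵇ_ (replicate (suc n) true) (replicate (suc n) false)
... | no _ = cong old (map-replicate not true (suc n))

hat-⊓-coatom : (x : Hat n) → x ≢ top → hat-⊓ x (old (replicate n true)) ≡ x
hat-⊓-coatom (old a) _      = cong old (zipWith-identityʳ ∧-identityʳ a)
hat-⊓-coatom top     x≢top = ⊥-elim (x≢top refl)

hat-⊓-top : (x : Hat n) → hat-⊓ x top ≡ x
hat-⊓-top (old _) = refl
hat-⊓-top top     = refl

hat-⊓-inverseʳ : (x : Hat n) → hat-⊓ x (hat-* x) ≡ old (replicate n false)
hat-⊓-inverseʳ     top     = refl
hat-⊓-inverseʳ {n} (old a) with ≡-dec _≟ᵇ_ a (replicate n false)
... | yes a≡0 = cong old a≡0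
... | no _    = cong old (zipWith-inverseʳ ∧-inverseʳ a)

module _ {q : ℕ} {f : Fin q → ℕ} where

  open Alg (ΠHat q f) using () renaming (_≈_ to _≈ᴴ_; _⊓_ to _⊓ᴴ_; _* to _*ᴴ; 𝟎 to 𝟎ᴴ)

  ΠHat-⊓-cong : Congruent₂ _≈ᴴ_ _⊓ᴴ_
  ΠHat-⊓-cong e e′ i = cong₂ hat-⊓ (e i) (e′ i)

  ΠHat-*-cong : Congruent₁ _≈ᴴ_ _*ᴴ
  ΠHat-*-cong e i = cong hat-* (e i)

  ΠHat-𝟎*-identityˡ : LeftIdentity _≈ᴴ_ (𝟎ᴴ *ᴴ) _⊓ᴴ_
  ΠHat-𝟎*-identityˡ x i = cong (λ y → hat-⊓ y (x i)) hat-*-𝟎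

  ΠHat-⊓-inverseʳ : RightInverse _≈ᴴ_ 𝟎ᴴ _*ᴴ _⊓ᴴ_
  ΠHat-⊓-inverseʳ x i = hat-⊓-inverseʳ (x i)

  coatom : Fin q → Carrier (ΠHat q f)
  coatom i j with i ≟ j
  ... | yes _ = old (replicate (f j) true)
  ... | no _  = top

  coatom-self : ∀ i → coatom i i ≡ old (replicate (f i) true)
  coatom-self i with i ≟ i
  ... | yes _  = refl
  ... | no i≢i = ⊥-elim (i≢i refl)

  coatom-dense : (∀ i → 1 ≤ f i) → ∀ i → (coatom i *ᴴ) ≈ᴴ 𝟎ᴴ
  coatom-dense f≥1 i j with i ≟ j
  ... | yes refl = hat-*-coatom (f≥1 i)
  ... | no _     = refl

  coatom≉𝟎* : ∀ i → ¬ coatom i ≈ᴴ (𝟎ᴴ *ᴴ)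
  coatom≉𝟎* i e with trans (sym (coatom-self i)) (trans (e i) hat-*-𝟎)
  ... | ()

  below-coatom : ∀ x i → x i ≢ top → (x ⊓ᴴ coatom i) ≈ᴴ x
  below-coatom x i xᵢ≢top j with i ≟ j
  ... | yes refl = hat-⊓-coatom (x i) xᵢ≢top
  ... | no _     = hat-⊓-top (x j)

  ΠHat-𝟎*-or-below-dense : (∀ i → 1 ≤ f i) → ∀ x →
    x ≈ᴴ (𝟎ᴴ *ᴴ) ⊎ ∃ λ d → (d *ᴴ) ≈ᴴ 𝟎ᴴ × ¬ d ≈ᴴ (𝟎ᴴ *ᴴ) × (x ⊓ᴴ d) ≈ᴴ x
  ΠHat-𝟎*-or-below-dense f≥1 x with all? (λ i → is-top? (x i))
  ... | yes x≡top = inj₁ λ i → trans (x≡top i) (sym hat-*-𝟎)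
  ... | no x≢top  = let i , xᵢ≢top = ¬∀⟶∃¬ q _ (λ i → is-top? (x i)) x≢top
                    in inj₂ (coatom i , coatom-dense f≥1 i , coatom≉𝟎* i , below-coatom x i xᵢ≢top)

lemma4p5 : (p q : ℕ) → 1 ≤ p → 1 ≤ q → (f : Fin q → ℕ) → (∀ i → 1 ≤ f i) →
    (S : Sub (TAlg p q f)) → SubAlg S ≅ ΠHat q f →
    Σ (Fin (suc p) → Sub (TAlg p q f)) (λ T →
      (T zero ≐ S)
      × (∀ (k : Fin p) → T (inject₁ k) ⊆ˢ T (suc k))
      × (∀ (k : Fin (suc p)) → SubAlg (T k) ≅ (Pow2 (toℕ k) ×A ΠHat q f)))
lemma4p5 p q _ _ f f≥1 S φ =
    (λ k → freeBelow (toℕ k))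
  , freeBelow-zero
  , (λ k → subst (λ m → freeBelow m ⊆ˢ freeBelow (suc (toℕ k))) (sym (toℕ-inject₁ k))
                 (freeBelow-suc (toℕ k)))
  , (λ k → ≅-trans (freeBelow-≅ proj₂-injective (toℕ≤pred[n] k)) (×A-congˡ φ))
  where
  open FreeCoordinates ΠHat-⊓-cong ΠHat-*-cong S using (freeBelow; freeBelow-zero; freeBelow-suc; freeBelow-≅)
  open ProjectionInjective ΠHat-⊓-cong ΠHat-*-cong ΠHat-𝟎*-identityˡ ΠHat-⊓-inverseʳ
                           (ΠHat-𝟎*-or-below-dense f≥1) S φ using (proj₂-injective)
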